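{- Let $k\ge 1$ and let $\mathcal H$ be a finite $(k+1)$-uniform bipartite hypergraph with bipartition $(A,B)$. If $X$ is an $A$-perfect matching of $\mathcal H$, then \[ \sum_{a\in A}|S_a(X)| = |S(X)| \le |A|\binom{k}{2}\big(\Delta_2(\mathcal H)-1\big), \] and if every vertex of $B$ has degree at most $D$, then \[ \sum_{a\in A}|T_a(X)| = |T(X)| \le (|B|-k|A|)D. \]
   Context: A hypergraph is bipartite with bipartition $(A,B)$ if $(A,B)$ partitions its vertex set and every edge contains exactly one vertex of $A$; it is $(k+1)$-uniform if every edge has $k+1$ vertices. $\Delta_2(\mathcal H)$ is the maximum over pairs of distinct vertices of the number of edges containing both. An $A$-perfect matching is a set of pairwise disjoint edges covering every vertex of $A$; for $a\in A$, $X_a$ denotes the edge of $X$ containing $a$. Define $S(X) = \{e\in E(\mathcal H): \text{there exists } a\in A \text{ with } e\neq X_a \text{ and } |X_a\cap e\cap B|\ge 2\}$, $T(X) = \{e\in E(\mathcal H): \text{there exists } v\in e \text{ such that } v\notin X_a \text{ for all } a\in A\}$, and for $a\in A$, $S_a(X)=\{e\in S(X): a\in e\}$ and $T_a(X)=\{e\in T(X): a\in e\}$. -}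

module Defs where

open import Data.Nat using (ℕ; _≤_; _⊔_; _≤?_)
open import Data.Nat.Properties using () renaming (_≟_ to _≟ℕ_)
open import Data.Bool using (Bool)
open import Data.Bool.Properties using () renaming (_≟_ to _≟B_)
open import Data.Fin using (Fin)
open import Data.Fin.Properties using (any?; all?) renaming (_≟_ to _≟F_)
open import Data.Fin.Subset using (Subset; _∈_; _∉_; _∩_; ∁; ∣_∣)
open import Data.Fin.Subset.Properties using (_∈?_)
open import Data.List using (List; length; filter; allFin; concatMap; map; foldr; [])
open import Data.Nat.ListAction using (sum)
open import Data.Empty using (⊥)
open import Data.List.Relation.Unary.Any as Any using (Any)
open import Data.List.Relation.Unary.All as All using (All)
open import Data.Product using (_×_; ∃)
open import Data.Vec.Properties using (≡-dec)
open import Relation.Nullary using (¬_; Dec; yes; no)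
open import Relation.Nullary.Decidable using (_×-dec_; ¬?)
open import Relation.Binary.PropositionalEquality using (_≡_)

-- Vertex set: Fin N.  A hypergraph is a finite list of edges, each edge a
-- subset of the vertex set.  A is a subset; B is its complement ∁ A.

Edge : ℕ → Set
Edge N = Subset N

_≟E_ : ∀ {N} (e f : Edge N) → Dec (e ≡ f)
_≟E_ = ≡-dec _≟B_

deg : ∀ {N} → List (Edge N) → Fin N → ℕ
deg E v = length (filter (λ e → v ∈? e) E)

codeg : ∀ {N} → List (Edge N) → Fin N → Fin N → ℕ
codeg E u v = length (filter (λ e → (u ∈? e) ×-dec (v ∈? e)) E)

Δ₂ : ∀ {N} → List (Edge N) → ℕ
Δ₂ {N} E = foldr _⊔_ 0
  (concatMap (λ u → map (codeg E u) (filter (λ v → ¬? (u ≟F v)) (allFin N))) (allFin N))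

-- X_a : the edge x of X with a ∈ x.  "∃ a ∈ A, e ≠ X_a, |X_a ∩ e ∩ B| ≥ 2"
InS : ∀ {N} (A : Subset N) (X : List (Edge N)) → Edge N → Set
InS A X e = ∃ λ a → a ∈ A × Any (λ x → a ∈ x × ¬ (e ≡ x) × 2 ≤ ∣ x ∩ (e ∩ ∁ A) ∣) X

InS? : ∀ {N} (A : Subset N) (X : List (Edge N)) (e : Edge N) → Dec (InS A X e)
InS? A X e = any? λ a → (a ∈? A) ×-dec
  Any.any? (λ x → (a ∈? x) ×-dec (¬? (e ≟E x) ×-dec (2 ≤? ∣ x ∩ (e ∩ ∁ A) ∣))) X

InT : ∀ {N} (A : Subset N) (X : List (Edge N)) → Edge N → Set
InT A X e = ∃ λ v → v ∈ e × (∀ a → a ∈ A → All (λ x → a ∈ x → v ∉ x) X)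

InT? : ∀ {N} (A : Subset N) (X : List (Edge N)) (e : Edge N) → Dec (InT A X e)
InT? A X e = any? λ v → (v ∈? e) ×-dec all? (λ a → (a ∈? A) →-dec
  All.all? (λ x → (a ∈? x) →-dec ¬? (v ∈? x)) X)
  where
  _→-dec_ : ∀ {P Q : Set} → Dec P → Dec Q → Dec (P → Q)
  _ →-dec yes q = yes (λ _ → q)
  no ¬p →-dec _ = yes (λ p → Data.Empty.⊥-elim (¬p p))
    where import Data.Empty
  yes p →-dec no ¬q = no (λ f → ¬q (f p))

-- S(X), T(X) as sublists of E (E has no repeated edges), and S_a, T_a
S : ∀ {N} → Subset N → List (Edge N) → List (Edge N) → List (Edge N)
S A E X = filter (InS? A X) E

T : ∀ {N} → Subset N → List (Edge N) → List (Edge N) → List (Edge N)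
T A E X = filter (InT? A X) E

Sₐ : ∀ {N} → Subset N → List (Edge N) → List (Edge N) → Fin N → List (Edge N)
Sₐ A E X a = filter (a ∈?_) (S A E X)

Tₐ : ∀ {N} → Subset N → List (Edge N) → List (Edge N) → Fin N → List (Edge N)
Tₐ A E X a = filter (a ∈?_) (T A E X)

sumOver : ∀ {N} → Subset N → (Fin N → ℕ) → ℕ
sumOver {N} A f = sum (map f (filter (_∈? A) (allFin N)))

Disjoint : ∀ {N} → Edge N → Edge N → Set
Disjoint x y = ∀ v → v ∈ x → v ∈ y → ⊥

-- Every edge meets A in exactly one vertex, so summing |S_a| (resp. |T_a|) over a ∈ A counts
-- each edge of S(X) (resp. T(X)) once. An edge of S(X) shares two B-vertices with the matching
-- edge X_a of some a ∈ A; X_a contains (k choose 2) such pairs, and each pair lies in at most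
-- Δ₂ - 1 edges other than X_a. An edge of T(X) contains a vertex uncovered by X; the at least
-- |A| disjoint matching edges cover at least k|A| vertices of B, so at most |B| - k|A| vertices
-- are uncovered, each lying in at most D edges.

module Submission where

open import Defs
open import Data.Nat using (ℕ; suc; _+_; _*_; _∸_; _≤_; _<_; _≤?_; _⊔_; z≤n; s≤s)
open import Data.Nat.Properties
open import Algebra.Properties.CommutativeSemigroup +-commutativeSemigroup using (interchange)
open import Data.Nat.Combinatorics using (_C_; nC1≡n; nCk+nC[k+1]≡[n+1]C[k+1])
open import Data.Nat.ListAction using (sum)
open import Data.Fin using (Fin) renaming (zero to fzero; suc to fsuc)
open import Data.Fin.Properties using () renaming (_≟_ to _≟F_; suc-injective to fsuc-injective)
open import Data.Fin.Subset using (Subset; _∈_; _∉_; _∩_; ∁; ∣_∣; inside; outside; Nonempty)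
open import Data.Fin.Subset.Properties using (_∈?_; x∈p∩q⁺; x∈p∩q⁻; x∉p⇒x∈∁p; drop-there)
open import Data.List using (List; []; _∷_; length; filter; allFin; map; tabulate; foldr; _++_)
open import Data.List.Properties using (length-map; length-++; map-cong; map-cong-local; filter-some; filter-none; filter-notAll)
open import Data.List.Membership.Propositional using (find) renaming (_∈_ to _∈ₗ_)
open import Data.List.Membership.Propositional.Properties
  using (∈-map⁺; ∈-map⁻; ∈-++⁺ˡ; ∈-++⁺ʳ; ∈-++⁻; ∈-filter⁺; ∈-filter⁻; ∈-allFin; ∈-concatMap⁺)
open import Data.List.Relation.Unary.All as All using (All; []; _∷_)
open import Data.List.Relation.Unary.Any as Any using (Any; here; there)
open import Data.List.Relation.Unary.AllPairs using (AllPairs; []; _∷_)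
open import Data.List.Relation.Unary.Unique.Propositional using (Unique)
open import Data.List.Relation.Unary.Unique.Propositional.Properties using (allFin⁺; filter⁺)
open import Data.Product using (_×_; _,_; proj₁; proj₂; ∃; ∃₂)
open import Data.Sum using (_⊎_; inj₁; inj₂)
import Data.Sum as Sum
open import Data.Vec.Base using ([]; _∷_; here; there)
open import Function using (id; _∘_; const)
open import Relation.Nullary using (Dec; yes; no; ¬_; contradiction)
open import Relation.Nullary.Decidable using (_×-dec_; ¬?)
open import Relation.Unary using (Decidable)
open import Relation.Binary.Definitions using (DecidableEquality)
open import Relation.Binary.PropositionalEquality using (_≡_; _≢_; refl; sym; trans; cong; cong₂; subst; module ≡-Reasoning)

private
  variable
    V W : Set
    n : ℕ

indicator : {P : Set} → Dec P → ℕ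
indicator (yes _) = 1
indicator (no _) = 0

count : {P : V → Set} → Decidable P → List V → ℕ
count P? xs = length (filter P? xs)

sum-map-+ : (f g : V → ℕ) (xs : List V) →
  sum (map (λ x → f x + g x) xs) ≡ sum (map f xs) + sum (map g xs)
sum-map-+ f g [] = refl
sum-map-+ f g (x ∷ xs) =
  trans (cong (f x + g x +_) (sum-map-+ f g xs)) (interchange (f x) (g x) _ _)

sum-map-const : (c : ℕ) (xs : List V) → sum (map (const c) xs) ≡ length xs * c
sum-map-const c [] = refl
sum-map-const c (x ∷ xs) = cong (c +_) (sum-map-const c xs)

sum-map-mono : {f g : V → ℕ} (xs : List V) →
  (∀ x → x ∈ₗ xs → f x ≤ g x) → sum (map f xs) ≤ sum (map g xs)
sum-map-mono [] _ = z≤n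
sum-map-mono (x ∷ xs) f≤g = +-mono-≤ (f≤g x (here refl)) (sum-map-mono xs (λ y → f≤g y ∘ there))

sum-map-swap : (f : V → W → ℕ) (vs : List V) (ws : List W) →
  sum (map (λ v → sum (map (f v) ws)) vs) ≡ sum (map (λ w → sum (map (λ v → f v w) vs)) ws)
sum-map-swap f vs [] = trans (sum-map-const 0 vs) (*-zeroʳ (length vs))
sum-map-swap f vs (w ∷ ws) =
  trans (sum-map-+ (λ v → f v w) (λ v → sum (map (f v) ws)) vs)
        (cong (sum (map (λ v → f v w) vs) +_) (sum-map-swap f vs ws))

length≤sum-map : {f : V → ℕ} (xs : List V) → (∀ x → x ∈ₗ xs → 1 ≤ f x) → length xs ≤ sum (map f xs)
length≤sum-map [] _ = z≤n
length≤sum-map (x ∷ xs) 1≤f = +-mono-≤ (1≤f x (here refl)) (length≤sum-map xs (λ y → 1≤f y ∘ there))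

count≡sum-indicator : {P : V → Set} (P? : Decidable P) (xs : List V) →
  count P? xs ≡ sum (map (indicator ∘ P?) xs)
count≡sum-indicator P? [] = refl
count≡sum-indicator P? (x ∷ xs) with P? x
... | yes _ = cong suc (count≡sum-indicator P? xs)
... | no _ = count≡sum-indicator P? xs

count+count¬≡length : {P : V → Set} (P? : Decidable P) (xs : List V) →
  count P? xs + count (¬? ∘ P?) xs ≡ length xs
count+count¬≡length P? [] = refl
count+count¬≡length P? (x ∷ xs) with P? x
... | yes _ = cong suc (count+count¬≡length P? xs)
... | no _ = trans (+-suc _ _) (cong suc (count+count¬≡length P? xs))

count-filter : {P Q : V → Set} (P? : Decidable P) (Q? : Decidable Q) (xs : List V) →
  count P? (filter Q? xs) ≡ count (λ x → Q? x ×-dec P? x) xs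
count-filter P? Q? [] = refl
count-filter P? Q? (x ∷ xs) with Q? x
... | no _ = count-filter P? Q? xs
... | yes _ with P? x
...   | yes _ = cong suc (count-filter P? Q? xs)
...   | no _ = count-filter P? Q? xs

count≤sum-map : {P : V → Set} (P? : Decidable P) {f : V → ℕ} (xs : List V) →
  (∀ x → x ∈ₗ xs → P x → 1 ≤ f x) → count P? xs ≤ sum (map f xs)
count≤sum-map P? {f} xs 1≤f = begin
  count P? xs                   ≡⟨ count≡sum-indicator P? xs ⟩
  sum (map (indicator ∘ P?) xs) ≤⟨ sum-map-mono xs (λ x x∈ → indicator≤ (P? x) (1≤f x x∈)) ⟩
  sum (map f xs)                ∎
  where
  open ≤-Reasoning
  indicator≤ : ∀ {P m} (P? : Dec P) → (P → 1 ≤ m) → indicator P? ≤ m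
  indicator≤ (yes p) 1≤m = 1≤m p
  indicator≤ (no _) _ = z≤n

count-mono : {P Q : V → Set} (P? : Decidable P) (Q? : Decidable Q) (xs : List V) →
  (∀ x → x ∈ₗ xs → P x → Q x) → count P? xs ≤ count Q? xs
count-mono P? Q? xs P⇒Q = ≤-trans
  (count≤sum-map P? xs (λ x x∈ px → indicator-yes (Q? x) (P⇒Q x x∈ px)))
  (≤-reflexive (sym (count≡sum-indicator Q? xs)))
  where
  indicator-yes : ∀ {Q} (Q? : Dec Q) → Q → 1 ≤ indicator Q?
  indicator-yes (yes _) _ = ≤-refl
  indicator-yes (no ¬q) q = contradiction q ¬q

double-count : {R : V → W → Set} (R? : ∀ v → Decidable (R v)) (vs : List V) (ws : List W) →
  sum (map (λ v → count (R? v) ws) vs) ≡ sum (map (λ w → count (λ v → R? v w) vs) ws)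
double-count R? vs ws = begin
  sum (map (λ v → count (R? v) ws) vs)
    ≡⟨ cong sum (map-cong (λ v → count≡sum-indicator (R? v) ws) vs) ⟩
  sum (map (λ v → sum (map (λ w → indicator (R? v w)) ws)) vs)
    ≡⟨ sum-map-swap (λ v w → indicator (R? v w)) vs ws ⟩
  sum (map (λ w → sum (map (λ v → indicator (R? v w)) vs)) ws)
    ≡⟨ cong sum (map-cong (λ w → sym (count≡sum-indicator (λ v → R? v w) vs)) ws) ⟩
  sum (map (λ w → count (λ v → R? v w) vs) ws) ∎
  where open ≡-Reasoning

union-bound : {P : W → Set} {Q : V → W → Set} (P? : Decidable P) (Q? : ∀ v → Decidable (Q v))
  (ws : List W) (vs : List V) → (∀ w → w ∈ₗ ws → P w → ∃ λ v → v ∈ₗ vs × Q v w) →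
  count P? ws ≤ sum (map (λ v → count (Q? v) ws) vs)
union-bound P? Q? ws vs covered = ≤-trans
  (count≤sum-map P? ws λ w w∈ pw → let v , v∈ , q = covered w w∈ pw in
    filter-some (λ v → Q? v w) (Any.map (λ { refl → q }) v∈))
  (≤-reflexive (sym (double-count Q? vs ws)))

count-≢<count : {P : V → Set} (P? : Decidable P) (_≟_ : DecidableEquality V) {x : V} {xs : List V} →
  x ∈ₗ xs → P x → count (λ y → P? y ×-dec ¬? (y ≟ x)) xs < count P? xs
count-≢<count P? _≟_ {x} {xs} x∈ px = begin-strict
  count (λ y → P? y ×-dec ¬? (y ≟ x)) xs ≡⟨ count-filter (λ y → ¬? (y ≟ x)) P? xs ⟨
  count (λ y → ¬? (y ≟ x)) (filter P? xs) <⟨ filter-notAll _ _ (Any.map (λ { refl x≢x → x≢x refl }) (∈-filter⁺ P? x∈ px)) ⟩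
  count P? xs ∎
  where open ≤-Reasoning

≤-foldr-⊔ : ∀ {y ys} → y ∈ₗ ys → y ≤ foldr _⊔_ 0 ys
≤-foldr-⊔ {ys = z ∷ zs} (here refl) = m≤m⊔n z _
≤-foldr-⊔ {ys = z ∷ zs} (there y∈) = ≤-trans (≤-foldr-⊔ y∈) (m≤n⊔m z _)

pairs : List V → List (V × V)
pairs [] = []
pairs (x ∷ xs) = map (x ,_) xs ++ pairs xs

length-pairs : (xs : List V) → length (pairs xs) ≡ length xs C 2
length-pairs [] = refl
length-pairs (x ∷ xs) = begin
  length (map (x ,_) xs ++ pairs xs)          ≡⟨ length-++ (map (x ,_) xs) ⟩
  length (map (x ,_) xs) + length (pairs xs)  ≡⟨ cong₂ _+_ (trans (length-map _ xs) (sym (nC1≡n _))) (length-pairs xs) ⟩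
  length xs C 1 + length xs C 2               ≡⟨ nCk+nC[k+1]≡[n+1]C[k+1] (length xs) 1 ⟩
  suc (length xs) C 2                         ∎
  where open ≡-Reasoning

∈-pairs⁺ : {u v : V} {xs : List V} → u ∈ₗ xs → v ∈ₗ xs → u ≢ v →
  (u , v) ∈ₗ pairs xs ⊎ (v , u) ∈ₗ pairs xs
∈-pairs⁺ (here refl) (here refl) u≢v = contradiction refl u≢v
∈-pairs⁺ (here refl) (there v∈) _ = inj₁ (∈-++⁺ˡ (∈-map⁺ _ v∈))
∈-pairs⁺ (there u∈) (here refl) _ = inj₂ (∈-++⁺ˡ (∈-map⁺ _ u∈))
∈-pairs⁺ {xs = x ∷ xs} (there u∈) (there v∈) u≢v =
  Sum.map (∈-++⁺ʳ (map (x ,_) xs)) (∈-++⁺ʳ (map (x ,_) xs)) (∈-pairs⁺ u∈ v∈ u≢v)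

∈-pairs⁻ : {u v : V} {xs : List V} → Unique xs → (u , v) ∈ₗ pairs xs → u ∈ₗ xs × v ∈ₗ xs × u ≢ v
∈-pairs⁻ {xs = x ∷ xs} (x≢xs ∷ unique) uv∈ with ∈-++⁻ (map (x ,_) xs) uv∈
... | inj₁ uv∈map with ∈-map⁻ (x ,_) uv∈map
...   | _ , v∈ , refl = here refl , there v∈ , All.lookup x≢xs v∈
∈-pairs⁻ {xs = x ∷ xs} (_ ∷ unique) uv∈ | inj₂ uv∈pairs =
  let u∈ , v∈ , u≢v = ∈-pairs⁻ unique uv∈pairs in there u∈ , there v∈ , u≢v

count-tabulate : {P : V → Set} (P? : Decidable P) (f : Fin n → V) (s : Subset n) →
  (∀ i → P (f i) → i ∈ s) → (∀ i → i ∈ s → P (f i)) → count P? (tabulate f) ≡ ∣ s ∣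
count-tabulate P? f [] _ _ = refl
count-tabulate P? f (b ∷ s) sound complete
  with ih ← count-tabulate P? (f ∘ fsuc) s (λ i → drop-there ∘ sound (fsuc i)) (λ i → complete (fsuc i) ∘ there)
     | P? (f fzero) | b
... | yes _ | inside  = cong suc ih
... | yes p | outside = contradiction (sound fzero p) λ ()
... | no ¬p | inside  = contradiction (complete fzero here) ¬p
... | no _  | outside = ih

elems : Subset n → List (Fin n)
elems {n} s = filter (_∈? s) (allFin n)

∈-elems⁺ : {s : Subset n} {i : Fin n} → i ∈ s → i ∈ₗ elems s
∈-elems⁺ {s = s} {i} = ∈-filter⁺ (_∈? s) (∈-allFin i)

∈-elems⁻ : {s : Subset n} {i : Fin n} → i ∈ₗ elems s → i ∈ s
∈-elems⁻ {n} {s} = proj₂ ∘ ∈-filter⁻ (_∈? s) {xs = allFin n}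

elems-unique : (s : Subset n) → Unique (elems s)
elems-unique {n} s = filter⁺ (_∈? s) (allFin⁺ n)

length-elems : (s : Subset n) → length (elems s) ≡ ∣ s ∣
length-elems s = count-tabulate (_∈? s) id s (λ _ → id) (λ _ → id)

count-∈-elems : (e s : Subset n) → count (_∈? e) (elems s) ≡ ∣ e ∩ s ∣
count-∈-elems {n} e s = trans (count-filter (_∈? e) (_∈? s) (allFin n))
  (count-tabulate _ id (e ∩ s)
    (λ _ (i∈s , i∈e) → x∈p∩q⁺ (i∈e , i∈s))
    (λ _ i∈e∩s → let i∈e , i∈s = x∈p∩q⁻ e s i∈e∩s in i∈s , i∈e))

∣p∣≡∣p∩q∣+∣p∩∁q∣ : (p q : Subset n) → ∣ p ∣ ≡ ∣ p ∩ q ∣ + ∣ p ∩ ∁ q ∣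
∣p∣≡∣p∩q∣+∣p∩∁q∣ [] [] = refl
∣p∣≡∣p∩q∣+∣p∩∁q∣ (inside ∷ p) (inside ∷ q) = cong suc (∣p∣≡∣p∩q∣+∣p∩∁q∣ p q)
∣p∣≡∣p∩q∣+∣p∩∁q∣ (inside ∷ p) (outside ∷ q) = trans (cong suc (∣p∣≡∣p∩q∣+∣p∩∁q∣ p q)) (sym (+-suc _ _))
∣p∣≡∣p∩q∣+∣p∩∁q∣ (outside ∷ p) (_ ∷ q) = ∣p∣≡∣p∩q∣+∣p∩∁q∣ p q

∣p∩∁q∣≡k : (p q : Subset n) {k : ℕ} → ∣ p ∣ ≡ suc k → ∣ p ∩ q ∣ ≡ 1 → ∣ p ∩ ∁ q ∣ ≡ k
∣p∩∁q∣≡k p q {k} ∣p∣≡1+k ∣p∩q∣≡1 = suc-injective (begin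
  suc ∣ p ∩ ∁ q ∣          ≡⟨ cong (_+ ∣ p ∩ ∁ q ∣) ∣p∩q∣≡1 ⟨
  ∣ p ∩ q ∣ + ∣ p ∩ ∁ q ∣  ≡⟨ ∣p∣≡∣p∩q∣+∣p∩∁q∣ p q ⟨
  ∣ p ∣                    ≡⟨ ∣p∣≡1+k ⟩
  suc k                    ∎)
  where open ≡-Reasoning

1≤∣p∣⇒Nonempty : (p : Subset n) → 1 ≤ ∣ p ∣ → Nonempty p
1≤∣p∣⇒Nonempty (inside ∷ p) _ = fzero , here
1≤∣p∣⇒Nonempty (outside ∷ p) 1≤∣p∣ = let i , i∈p = 1≤∣p∣⇒Nonempty p 1≤∣p∣ in fsuc i , there i∈p

2≤∣p∣⇒distinct-members : (p : Subset n) → 2 ≤ ∣ p ∣ → ∃₂ λ u v → u ≢ v × u ∈ p × v ∈ p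
2≤∣p∣⇒distinct-members (inside ∷ p) (s≤s 1≤∣p∣) =
  let v , v∈p = 1≤∣p∣⇒Nonempty p 1≤∣p∣ in fzero , fsuc v , (λ ()) , here , there v∈p
2≤∣p∣⇒distinct-members (outside ∷ p) 2≤∣p∣ =
  let u , v , u≢v , u∈p , v∈p = 2≤∣p∣⇒distinct-members p 2≤∣p∣
  in fsuc u , fsuc v , u≢v ∘ fsuc-injective , there u∈p , there v∈p

codeg≤Δ₂ : ∀ {N} (E : List (Edge N)) {u v : Fin N} → u ≢ v → codeg E u v ≤ Δ₂ E
codeg≤Δ₂ {N} E {u} {v} u≢v = ≤-foldr-⊔ (∈-concatMap⁺ _ (Any.map (λ { refl →
  ∈-map⁺ (codeg E u) (∈-filter⁺ (λ w → ¬? (u ≟F w)) (∈-allFin v) u≢v) }) (∈-allFin u)))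

ThroughPair : ∀ {N} → Edge N → Fin N × Fin N → Edge N → Set
ThroughPair x (u , v) e = (u ∈ e × v ∈ e) × ¬ (e ≡ x)

throughPair? : ∀ {N} (x : Edge N) (p : Fin N × Fin N) → Decidable (ThroughPair x p)
throughPair? x (u , v) e = (u ∈? e ×-dec v ∈? e) ×-dec ¬? (e ≟E x)

-- x itself is one of the edges counted by the codegree, hence the - 1.
count-throughPair≤ : ∀ {N} (E : List (Edge N)) {x : Edge N} → x ∈ₗ E → {u v : Fin N} →
  u ≢ v → u ∈ x → v ∈ x → count (throughPair? x (u , v)) E ≤ Δ₂ E ∸ 1
count-throughPair≤ E x∈E {u} {v} u≢v u∈x v∈x = m+n≤o⇒m≤o∸n _ (begin
  count (throughPair? _ (u , v)) E + 1 ≡⟨ +-comm _ 1 ⟩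
  suc (count (throughPair? _ (u , v)) E) ≤⟨ count-≢<count (λ e → u ∈? e ×-dec v ∈? e) _≟E_ x∈E (u∈x , v∈x) ⟩
  codeg E u v ≤⟨ codeg≤Δ₂ E u≢v ⟩
  Δ₂ E ∎)
  where open ≤-Reasoning

SharesPair : ∀ {N} → Subset N → Edge N → Edge N → Set
SharesPair B x e = ¬ (e ≡ x) × 2 ≤ ∣ x ∩ (e ∩ B) ∣

sharesPair? : ∀ {N} (B : Subset N) (x : Edge N) → Decidable (SharesPair B x)
sharesPair? B x e = ¬? (e ≟E x) ×-dec (2 ≤? ∣ x ∩ (e ∩ B) ∣)

count-sharesPair≤ : ∀ {N} (E : List (Edge N)) (B : Subset N) {x : Edge N} → x ∈ₗ E →
  count (sharesPair? B x) E ≤ (∣ x ∩ B ∣ C 2) * (Δ₂ E ∸ 1)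
count-sharesPair≤ E B {x} x∈E = begin
  count (sharesPair? B x) E
    ≤⟨ union-bound (sharesPair? B x) (throughPair? x) E (pairs xB) sharedPair ⟩
  sum (map (λ p → count (throughPair? x p) E) (pairs xB))
    ≤⟨ sum-map-mono (pairs xB) pairBound ⟩
  sum (map (const (Δ₂ E ∸ 1)) (pairs xB))
    ≡⟨ sum-map-const _ (pairs xB) ⟩
  length (pairs xB) * (Δ₂ E ∸ 1)
    ≡⟨ cong (_* (Δ₂ E ∸ 1)) (trans (length-pairs xB) (cong (_C 2) (length-elems (x ∩ B)))) ⟩
  (∣ x ∩ B ∣ C 2) * (Δ₂ E ∸ 1) ∎
  where
  open ≤-Reasoning
  xB = elems (x ∩ B)
  ∈-xB∩e : ∀ e {i} → i ∈ x ∩ (e ∩ B) → i ∈ₗ xB × i ∈ e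
  ∈-xB∩e e i∈ = let i∈x , i∈eB = x∈p∩q⁻ x _ i∈ ; i∈e , i∈B = x∈p∩q⁻ e B i∈eB
                in ∈-elems⁺ (x∈p∩q⁺ (i∈x , i∈B)) , i∈e
  sharedPair : ∀ e → e ∈ₗ E → SharesPair B x e → ∃ λ p → p ∈ₗ pairs xB × ThroughPair x p e
  sharedPair e _ (e≢x , 2≤) with 2≤∣p∣⇒distinct-members (x ∩ (e ∩ B)) 2≤
  ... | u , v , u≢v , u∈ , v∈ with ∈-xB∩e e u∈ | ∈-xB∩e e v∈
  ... | u∈xB , u∈e | v∈xB , v∈e with ∈-pairs⁺ u∈xB v∈xB u≢v
  ... | inj₁ uv∈ = (u , v) , uv∈ , (u∈e , v∈e) , e≢x
  ... | inj₂ vu∈ = (v , u) , vu∈ , (v∈e , u∈e) , e≢x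
  pairBound : ∀ p → p ∈ₗ pairs xB → count (throughPair? x p) E ≤ Δ₂ E ∸ 1
  pairBound (u , v) uv∈ =
    let u∈ , v∈ , u≢v = ∈-pairs⁻ (elems-unique (x ∩ B)) uv∈
    in count-throughPair≤ E x∈E u≢v (proj₁ (x∈p∩q⁻ x B (∈-elems⁻ u∈))) (proj₁ (x∈p∩q⁻ x B (∈-elems⁻ v∈)))

sumOver-count-∈≡length : ∀ {N} (A : Subset N) (L : List (Edge N)) →
  (∀ e → e ∈ₗ L → ∣ e ∩ A ∣ ≡ 1) → sumOver A (λ a → count (a ∈?_) L) ≡ length L
sumOver-count-∈≡length A L one-in-A = begin
  sum (map (λ a → count (a ∈?_) L) (elems A)) ≡⟨ double-count _∈?_ (elems A) L ⟩
  sum (map (λ e → count (_∈? e) (elems A)) L) ≡⟨ cong sum (map-cong-local (All.tabulate λ {e} e∈L →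
                                                   trans (count-∈-elems e A) (one-in-A e e∈L))) ⟩
  sum (map (const 1) L)                        ≡⟨ sum-map-const 1 L ⟩
  length L * 1                                 ≡⟨ *-identityʳ _ ⟩
  length L                                     ∎
  where open ≡-Reasoning

module _ {N} {X : List (Edge N)} (disjoint : AllPairs Disjoint X) where

  ≡-of-common-member : {x y : Edge N} {a : Fin N} → x ∈ₗ X → y ∈ₗ X → a ∈ x → a ∈ y → x ≡ y
  ≡-of-common-member = go disjoint
    where
    go : ∀ {X x y a} → AllPairs Disjoint X → x ∈ₗ X → y ∈ₗ X → a ∈ x → a ∈ y → x ≡ y
    go (_ ∷ _) (here refl) (here refl) _ _ = refl
    go (x#X ∷ _) (here refl) (there y∈) a∈x a∈y = contradiction a∈y (All.lookup x#X y∈ _ a∈x)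
    go (y#X ∷ _) (there x∈) (here refl) a∈x a∈y = contradiction a∈x (All.lookup y#X x∈ _ a∈y)
    go (_ ∷ pairwise) (there x∈) (there y∈) a∈x a∈y = go pairwise x∈ y∈ a∈x a∈y

  count-∈≤1 : (v : Fin N) → count (v ∈?_) X ≤ 1
  count-∈≤1 v = go disjoint
    where
    go : ∀ {X} → AllPairs Disjoint X → count (v ∈?_) X ≤ 1
    go [] = z≤n
    go {x ∷ _} (x#X ∷ pairwise) with v ∈? x
    ... | yes v∈x = ≤-reflexive (cong (suc ∘ length) (filter-none (v ∈?_) (All.map (λ x#y → x#y v v∈x) x#X)))
    ... | no _ = go pairwise

Uncovered : ∀ {N} → List (Edge N) → Fin N → Set
Uncovered X v = All (v ∉_) X

uncovered? : ∀ {N} (X : List (Edge N)) → Decidable (Uncovered X)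
uncovered? X v = All.all? (λ x → ¬? (v ∈? x)) X

module Matching {N} (A : Subset N) (X : List (Edge N))
  (disjoint : AllPairs Disjoint X) (covers : ∀ a → a ∈ A → ∃ λ x → x ∈ₗ X × a ∈ x) where

  length-S≤ : ∀ k (E : List (Edge N)) → (∀ x → x ∈ₗ X → x ∈ₗ E) → (∀ x → x ∈ₗ X → ∣ x ∩ ∁ A ∣ ≡ k) →
    length (S A E X) ≤ ∣ A ∣ * (k C 2) * (Δ₂ E ∸ 1)
  length-S≤ k E X⊆E ∣x∩B∣≡k = begin
    count (InS? A X) E
      ≤⟨ union-bound (InS? A X) sharesPairWithMatched? E (elems A) (λ { _ _ (a , a∈A , q) → a , ∈-elems⁺ a∈A , q }) ⟩
    sum (map (λ a → count (sharesPairWithMatched? a) E) (elems A))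
      ≤⟨ sum-map-mono (elems A) (λ a → perVertex a ∘ ∈-elems⁻) ⟩
    sum (map (const c) (elems A))
      ≡⟨ sum-map-const c (elems A) ⟩
    length (elems A) * c
      ≡⟨ cong (_* c) (length-elems A) ⟩
    ∣ A ∣ * c
      ≡⟨ *-assoc ∣ A ∣ (k C 2) (Δ₂ E ∸ 1) ⟨
    ∣ A ∣ * (k C 2) * (Δ₂ E ∸ 1) ∎
    where
    open ≤-Reasoning
    c = (k C 2) * (Δ₂ E ∸ 1)
    sharesPairWithMatched? : ∀ a e → Dec (Any (λ x → a ∈ x × SharesPair (∁ A) x e) X)
    sharesPairWithMatched? a e = Any.any? (λ x → a ∈? x ×-dec sharesPair? (∁ A) x e) X
    perVertex : ∀ a → a ∈ A → count (sharesPairWithMatched? a) E ≤ c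
    perVertex a a∈A with covers a a∈A
    ... | xₐ , xₐ∈X , a∈xₐ = begin
      count (sharesPairWithMatched? a) E
        ≤⟨ count-mono _ (sharesPair? (∁ A) xₐ) E (λ e _ q →
             let x , x∈X , a∈x , shares = find q
             in subst (λ y → SharesPair (∁ A) y e) (≡-of-common-member disjoint x∈X xₐ∈X a∈x a∈xₐ) shares) ⟩
      count (sharesPair? (∁ A) xₐ) E
        ≤⟨ count-sharesPair≤ E (∁ A) (X⊆E xₐ xₐ∈X) ⟩
      (∣ xₐ ∩ ∁ A ∣ C 2) * (Δ₂ E ∸ 1)
        ≡⟨ cong (λ m → (m C 2) * (Δ₂ E ∸ 1)) (∣x∩B∣≡k xₐ xₐ∈X) ⟩
      c ∎

  module _ (one-in-A : ∀ x → x ∈ₗ X → ∣ x ∩ A ∣ ≡ 1) where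

    ∣A∣≤length : ∣ A ∣ ≤ length X
    ∣A∣≤length = begin
      ∣ A ∣                                        ≡⟨ length-elems A ⟨
      length (elems A)                             ≤⟨ length≤sum-map (elems A) (λ a → covered ∘ ∈-elems⁻) ⟩
      sum (map (λ a → count (a ∈?_) X) (elems A)) ≡⟨ sumOver-count-∈≡length A X one-in-A ⟩
      length X                                     ∎
      where
      open ≤-Reasoning
      covered : ∀ {a} → a ∈ A → 1 ≤ count (a ∈?_) X
      covered {a} a∈A = let x , x∈X , a∈x = covers a a∈A in filter-some (a ∈?_) (Any.map (λ { refl → a∈x }) x∈X)

    InT⇒uncovered-member : ∀ {e} → InT A X e → ∃ λ v → v ∈ₗ filter (uncovered? X) (elems (∁ A)) × v ∈ e
    InT⇒uncovered-member (v , v∈e , avoids) = v , ∈-filter⁺ (uncovered? X) (∈-elems⁺ (x∉p⇒x∈∁p v∉A)) uncovered , v∈e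
      where
      v∉A : v ∉ A
      v∉A v∈A = let x , x∈X , v∈x = covers v v∈A in All.lookup (avoids v v∈A) x∈X v∈x v∈x
      uncovered : Uncovered X v
      uncovered = All.tabulate λ {x} x∈X →
        let a , a∈x∩A = 1≤∣p∣⇒Nonempty (x ∩ A) (≤-reflexive (sym (one-in-A x x∈X)))
            a∈x , a∈A = x∈p∩q⁻ x A a∈x∩A
        in All.lookup (avoids a a∈A) x∈X a∈x

    -- Each of the ≥ |A| matching edges has k vertices in B, and no B-vertex is counted twice.
    k*∣A∣≤covered : ∀ k → (∀ x → x ∈ₗ X → ∣ x ∩ ∁ A ∣ ≡ k) →
      k * ∣ A ∣ ≤ count (¬? ∘ uncovered? X) (elems (∁ A))
    k*∣A∣≤covered k ∣x∩B∣≡k = begin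
      k * ∣ A ∣                                        ≤⟨ *-monoʳ-≤ k ∣A∣≤length ⟩
      k * length X                                     ≡⟨ *-comm k _ ⟩
      length X * k                                     ≡⟨ sum-map-const k X ⟨
      sum (map (const k) X)                            ≡⟨ cong sum (map-cong-local (All.tabulate λ {x} x∈X →
                                                          trans (sym (∣x∩B∣≡k x x∈X)) (sym (count-∈-elems x (∁ A))))) ⟩
      sum (map (λ x → count (_∈? x) (elems (∁ A))) X) ≡⟨ double-count _∈?_ (elems (∁ A)) X ⟨
      sum (map (λ v → count (v ∈?_) X) (elems (∁ A))) ≤⟨ sum-map-mono (elems (∁ A)) (λ v _ → count-∈≤indicator v) ⟩
      sum (map (indicator ∘ (¬? ∘ uncovered? X)) (elems (∁ A))) ≡⟨ count≡sum-indicator _ (elems (∁ A)) ⟨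
      count (¬? ∘ uncovered? X) (elems (∁ A))          ∎
      where
      open ≤-Reasoning
      count-∈≤indicator : ∀ v → count (v ∈?_) X ≤ indicator (¬? (uncovered? X v))
      count-∈≤indicator v with uncovered? X v
      ... | yes v∉X = ≤-reflexive (cong length (filter-none (v ∈?_) v∉X))
      ... | no _ = count-∈≤1 disjoint v

    length-T≤ : ∀ k D (E : List (Edge N)) → (∀ x → x ∈ₗ X → ∣ x ∩ ∁ A ∣ ≡ k) →
      (∀ b → b ∈ ∁ A → deg E b ≤ D) → length (T A E X) ≤ (∣ ∁ A ∣ ∸ k * ∣ A ∣) * D
    length-T≤ k D E ∣x∩B∣≡k deg≤D = begin
      count (InT? A X) E
        ≤⟨ union-bound (InT? A X) _∈?_ E U (λ _ _ → InT⇒uncovered-member) ⟩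
      sum (map (deg E) U)
        ≤⟨ sum-map-mono U (λ v v∈U → deg≤D v (∈-elems⁻ (proj₁ (∈-filter⁻ (uncovered? X) v∈U)))) ⟩
      sum (map (const D) U)
        ≡⟨ sum-map-const D U ⟩
      length U * D
        ≤⟨ *-monoˡ-≤ D (m+n≤o⇒m≤o∸n (length U) length-U+k*∣A∣≤∣B∣) ⟩
      (∣ ∁ A ∣ ∸ k * ∣ A ∣) * D ∎
      where
      open ≤-Reasoning
      U = filter (uncovered? X) (elems (∁ A))
      length-U+k*∣A∣≤∣B∣ : length U + k * ∣ A ∣ ≤ ∣ ∁ A ∣
      length-U+k*∣A∣≤∣B∣ = begin
        length U + k * ∣ A ∣
          ≤⟨ +-monoʳ-≤ (length U) (k*∣A∣≤covered k ∣x∩B∣≡k) ⟩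
        length U + count (¬? ∘ uncovered? X) (elems (∁ A))
          ≡⟨ count+count¬≡length (uncovered? X) (elems (∁ A)) ⟩
        length (elems (∁ A))
          ≡⟨ length-elems (∁ A) ⟩
        ∣ ∁ A ∣ ∎

lemma3p3 : (k : ℕ) → 1 ≤ k → (N : ℕ) → (A : Subset N) → (E : List (Edge N))
    → Unique E
    → (∀ e → e ∈ₗ E → ∣ e ∣ ≡ suc k)
    → (∀ e → e ∈ₗ E → ∣ e ∩ A ∣ ≡ 1)
    → (X : List (Edge N))
    → (∀ x → x ∈ₗ X → x ∈ₗ E)
    → AllPairs Disjoint X
    → (∀ a → a ∈ A → ∃ λ x → x ∈ₗ X × a ∈ x)
    → (sumOver A (λ a → length (Sₐ A E X a)) ≡ length (S A E X)
       × length (S A E X) ≤ ∣ A ∣ * (k C 2) * (Δ₂ E ∸ 1))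
    × ((D : ℕ) → (∀ b → b ∈ ∁ A → deg E b ≤ D)
       → sumOver A (λ a → length (Tₐ A E X a)) ≡ length (T A E X)
         × length (T A E X) ≤ (∣ ∁ A ∣ ∸ k * ∣ A ∣) * D)
lemma3p3 k _ N A E _ size one-in-A X X⊆E disjoint covers =
  ( sumOver-count-∈≡length A (S A E X) (λ e → one-in-A e ∘ proj₁ ∘ ∈-filter⁻ (InS? A X))
  , length-S≤ k E X⊆E ∣x∩B∣≡k )
  , λ D deg≤D →
    ( sumOver-count-∈≡length A (T A E X) (λ e → one-in-A e ∘ proj₁ ∘ ∈-filter⁻ (InT? A X))
    , length-T≤ (λ x → one-in-A x ∘ X⊆E x) k D E ∣x∩B∣≡k deg≤D )
  where
  open Matching A X disjoint covers
  ∣x∩B∣≡k : ∀ x → x ∈ₗ X → ∣ x ∩ ∁ A ∣ ≡ k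
  ∣x∩B∣≡k x x∈X = ∣p∩∁q∣≡k x A (size x (X⊆E x x∈X)) (one-in-A x (X⊆E x x∈X))
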